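{- Let $\lambda,\mu,\alpha,\beta$ be partitions with $\mu\subseteq\lambda$ and $\beta\subseteq\alpha$, and assume $\lambda-\mu=\alpha-\beta$ as sets of cells. Then $s_{\lambda/\mu}=s_{\alpha/\beta}$.
   Context: $\mu\subseteq\lambda$ means $\mu_i\le\lambda_i$ for all $i$; the Young diagram of $\lambda$ is $\{(i,j): i\ge1,\ 1\le j\le\lambda_i\}$ and $\lambda-\mu$ is the set difference of Young diagrams. $R$ is the polynomial ring over $\mathbb{Z}$ in indeterminates $h_{r,s}$ ($r\ge1$, $s\in\mathbb{Z}$); set $h_{0,s}=1$ and $h_{r,s}=0$ for $r<0$. $\varphi$ is the ring automorphism of $R$ with $\varphi(h_{r,s})=h_{r,s+1}$, and $h_r:=h_{r,0}$, so $\varphi^sh_r=h_{r,s}$. For partitions $\lambda,\mu$ and any $n$ with $\ell(\lambda),\ell(\mu)\le n$ (where $\ell$ is the number of nonzero parts), $s_{\lambda/\mu}=\det\left(\varphi^{\mu_j-j+1}h_{\lambda_i-\mu_j-i+j}\right)_{1\le i,j\le n}$ (independent of $n$). -}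

module Defs where

open import Level using (Level)
open import Data.Nat using (ℕ; zero; suc; _≤_; _<_; _⊔_; _≥_)
open import Data.Integer as ℤ using (ℤ; +_; -[1+_])
open import Data.Fin using (Fin; toℕ; punchIn)
import Data.Fin as Fin
open import Data.List using (List; []; _∷_; length)
open import Data.List.Relation.Unary.All using (All)
open import Data.List.Relation.Unary.Linked using (Linked)
open import Data.Product using (_×_)
open import Relation.Nullary using (¬_)
open import Algebra.Bundles using (CommutativeRing)

record Partition : Set where
  constructor mkPartition
  field
    parts      : List ℕ
    decreasing : Linked _≥_ parts
    positive   : All (λ p → 1 ≤ p) parts

open Partition public

ℓ : Partition → ℕ
ℓ λp = length (parts λp)

nth : List ℕ → ℕ → ℕ
nth []       _       = 0
nth (x ∷ xs) zero    = x
nth (x ∷ xs) (suc i) = nth xs i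

-- λ_i for i ≥ 1 (1-based); the value at i = 0 is an unused convention
part : Partition → ℕ → ℕ
part λp zero    = 0
part λp (suc i) = nth (parts λp) i

_⊆ₚ_ : Partition → Partition → Set
μ ⊆ₚ λp = ∀ i → 1 ≤ i → part μ i ≤ part λp i

InDiagram : Partition → ℕ → ℕ → Set
InDiagram λp i j = 1 ≤ i × 1 ≤ j × j ≤ part λp i

InSkew : Partition → Partition → ℕ → ℕ → Set
InSkew λp μ i j = InDiagram λp i j × ¬ InDiagram μ i j

module _ {c ℓ' : Level} (A : CommutativeRing c ℓ') where
  open CommutativeRing A

  sumFin : ∀ n → (Fin n → Carrier) → Carrier
  sumFin zero    f = 0#
  sumFin (suc n) f = f Fin.zero + sumFin n (λ j → f (Fin.suc j))

  sign : ℕ → Carrier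
  sign zero    = 1#
  sign (suc k) = - sign k

  det : ∀ n → (Fin n → Fin n → Carrier) → Carrier
  det zero    M = 1#
  det (suc n) M =
    sumFin (suc n) (λ j → sign (toℕ j) * (M Fin.zero j *
      det n (λ i k → M (Fin.suc i) (punchIn j k))))

  -- Evaluation of h_{r,s} under an assignment x of the indeterminates:
  -- x r s is the value of h_{r,s} for r ≥ 1 (x 0 s is ignored);
  -- h_{0,s} = 1 and h_{r,s} = 0 for r < 0.
  hEval : (ℕ → ℤ → Carrier) → ℤ → ℤ → Carrier
  hEval x (+ zero)    s = 1#
  hEval x (+ (suc r)) s = x (suc r) s
  hEval x -[1+ r ]    s = 0#

  -- the Jacobi–Trudi matrix (φ^{μ_j-j+1} h_{λ_i-μ_j-i+j})_{1≤i,j≤n}, evaluated at x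
  jtMatrix : (ℕ → ℤ → Carrier) → Partition → Partition → ∀ n → Fin n → Fin n → Carrier
  jtMatrix x λp μ n i j =
    hEval x ((((+ part λp i') ℤ.- (+ part μ j')) ℤ.- (+ i')) ℤ.+ (+ j'))
            (((+ part μ j') ℤ.- (+ j')) ℤ.+ (+ 1))
    where
      i' = suc (toℕ i)
      j' = suc (toℕ j)

  skewSchur : (ℕ → ℤ → Carrier) → Partition → Partition → Carrier
  skewSchur x λp μ = det n (jtMatrix x λp μ n)
    where n = ℓ λp ⊔ ℓ μ

-- Index rows from 0 and put a_r = λ_(r+1), b_r = μ_(r+1). The (i, j) entry of the Jacobi–Trudi
-- matrix has degree a_i − b_j − i + j, so it vanishes when a_i ≤ b_j and j < i. If row r of the
-- skew diagram is empty (a_r = b_r), monotonicity gives a_i ≤ a_r = b_r ≤ b_j for i ≥ r ≥ j, so the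
-- matrix is block triangular on both sides of r, with diagonal entry h_0 = 1 at r. Hence the
-- determinant is the product of the determinants of the blocks between empty rows, and trailing
-- empty rows do not change it. Equal skew diagrams have, in every row, either the same endpoints
-- (λ_r, μ_r) = (α_r, β_r) or an empty row in both; after padding both determinants to a common
-- size their blocks between empty rows are identical.

module Submission where

open import Defs
open import Data.Nat using (ℕ)
open import Data.Integer using (ℤ)
open import Function.Bundles using (_⇔_)
open import Algebra.Bundles using (CommutativeRing)

open import Level using (Level)
open import Data.Nat as ℕ using (zero; suc; pred; z≤n; s≤s; _∸_; _≤_; _<_; _≥_; _⊔_; _<?_)
open import Data.Nat.Properties
  using ( ≤-refl; ≤-trans; ≤-antisym; <-≤-trans; ≤-<-trans; <⇒≤; <⇒≱; ≮⇒≥; ≰⇒>; n≮0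
        ; m<1+n⇒m≤n; m≤m+n; m<m+n; m≤m⊔n; m≤n⊔m; pred[n]≤n
        ; +-monoʳ-≤; +-monoʳ-<; +-mono-≤-<; m≤n⇒m<n∨m≡n )
import Data.Nat.Properties as ℕₚ
open import Data.Integer as ℤ using (+_; -[1+_]; +<+; 0ℤ)
import Data.Integer.Properties as ℤ
open import Data.Integer.Tactic.RingSolver using (solve-∀)
open import Data.Fin as Fin using (Fin; toℕ; punchIn; _↑ˡ_; _↑ʳ_)
open import Data.Fin.Properties using (toℕ<n; toℕ≤pred[n]; toℕ-↑ˡ; toℕ-↑ʳ)
open import Data.List using ([]; _∷_; length)
open import Data.List.Relation.Unary.Linked using (Linked; []; [-]; _∷_)
open import Data.Product using (_×_; _,_; proj₁; proj₂)
open import Data.Sum using (_⊎_; inj₁; inj₂)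
open import Data.Empty using (⊥-elim)
open import Function.Bundles using (mk⇔; Equivalence)
import Function.Properties.Equivalence as ⇔
open import Relation.Binary.Definitions using (Antitonic₁)
open import Relation.Binary.PropositionalEquality using (_≡_; cong; subst)
import Relation.Binary.PropositionalEquality as ≡
open import Relation.Nullary using (yes; no)

toℕ-punchIn-< : ∀ {n} (j : Fin (suc n)) (k : Fin n) → toℕ k < toℕ j → toℕ (punchIn j k) ≡ toℕ k
toℕ-punchIn-< (Fin.suc j) Fin.zero    _         = ≡.refl
toℕ-punchIn-< (Fin.suc j) (Fin.suc k) (s≤s k<j) = cong suc (toℕ-punchIn-< j k k<j)

toℕ-punchIn-≤ : ∀ {n} (j : Fin (suc n)) (k : Fin n) → toℕ (punchIn j k) ≤ suc (toℕ k)
toℕ-punchIn-≤ Fin.zero    k           = ≤-refl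
toℕ-punchIn-≤ (Fin.suc j) Fin.zero    = z≤n
toℕ-punchIn-≤ (Fin.suc j) (Fin.suc k) = s≤s (toℕ-punchIn-≤ j k)

punchIn-↑ˡ : ∀ {k} m (j : Fin (suc k)) (c : Fin k) → punchIn (j ↑ˡ m) (c ↑ˡ m) ≡ punchIn j c ↑ˡ m
punchIn-↑ˡ m Fin.zero    c           = ≡.refl
punchIn-↑ˡ m (Fin.suc j) Fin.zero    = ≡.refl
punchIn-↑ˡ m (Fin.suc j) (Fin.suc c) = cong Fin.suc (punchIn-↑ˡ m j c)

punchIn-↑ˡ-↑ʳ : ∀ k {m} (j : Fin (suc k)) (c : Fin m) → punchIn (j ↑ˡ m) (k ↑ʳ c) ≡ Fin.suc (k ↑ʳ c)
punchIn-↑ˡ-↑ʳ zero    Fin.zero    c = ≡.refl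
punchIn-↑ˡ-↑ʳ (suc k) Fin.zero    c = ≡.refl
punchIn-↑ˡ-↑ʳ (suc k) (Fin.suc j) c = cong Fin.suc (punchIn-↑ˡ-↑ʳ k j c)

module Determinant {c ℓ : Level} (A : CommutativeRing c ℓ) where
  open CommutativeRing A
  open import Relation.Binary.Reasoning.Setoid setoid

  Matrix : ℕ → Set c
  Matrix n = Fin n → Fin n → Carrier

  sumFin-cong : ∀ n {f g : Fin n → Carrier} → (∀ j → f j ≈ g j) → sumFin A n f ≈ sumFin A n g
  sumFin-cong zero    f≈g = refl
  sumFin-cong (suc n) f≈g = +-cong (f≈g Fin.zero) (sumFin-cong n (λ j → f≈g (Fin.suc j)))

  sumFin-zero : ∀ n {f : Fin n → Carrier} → (∀ j → f j ≈ 0#) → sumFin A n f ≈ 0#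
  sumFin-zero zero    f≈0 = refl
  sumFin-zero (suc n) f≈0 =
    trans (+-cong (f≈0 Fin.zero) (sumFin-zero n (λ j → f≈0 (Fin.suc j)))) (+-identityˡ 0#)

  sumFin-split : ∀ k m (f : Fin (k ℕ.+ m) → Carrier) →
    sumFin A (k ℕ.+ m) f ≈ sumFin A k (λ j → f (j ↑ˡ m)) + sumFin A m (λ j → f (k ↑ʳ j))
  sumFin-split zero    m f = sym (+-identityˡ _)
  sumFin-split (suc k) m f =
    trans (+-cong refl (sumFin-split k m (λ j → f (Fin.suc j)))) (sym (+-assoc _ _ _))

  *-distribʳ-sumFin : ∀ n (f : Fin n → Carrier) y → sumFin A n f * y ≈ sumFin A n (λ j → f j * y)
  *-distribʳ-sumFin zero    f y = zeroˡ y
  *-distribʳ-sumFin (suc n) f y =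
    trans (distribʳ y _ _) (+-cong refl (*-distribʳ-sumFin n (λ j → f (Fin.suc j)) y))

  minor : ∀ {n} → Matrix (suc n) → Fin (suc n) → Matrix n
  minor M j i k = M (Fin.suc i) (punchIn j k)

  laplaceTerm : ∀ {n} → Matrix (suc n) → Fin (suc n) → Carrier
  laplaceTerm {n} M j = sign A (toℕ j) * (M Fin.zero j * det A n (minor M j))

  laplaceTerm-zero : ∀ {n} (M : Matrix (suc n)) j →
    M Fin.zero j ≈ 0# ⊎ det A n (minor M j) ≈ 0# → laplaceTerm M j ≈ 0#
  laplaceTerm-zero M j (inj₁ e) = trans (*-cong refl (trans (*-cong e refl) (zeroˡ _))) (zeroʳ _)
  laplaceTerm-zero M j (inj₂ e) = trans (*-cong refl (trans (*-cong refl e) (zeroʳ _))) (zeroʳ _)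

  det-cong : ∀ n {M N : Matrix n} → (∀ i j → M i j ≈ N i j) → det A n M ≈ det A n N
  det-cong zero    M≈N = refl
  det-cong (suc n) M≈N = sumFin-cong (suc n) λ j →
    *-cong (refl {sign A (toℕ j)}) (*-cong (M≈N Fin.zero j) (det-cong n λ i k → M≈N (Fin.suc i) (punchIn j k)))

  det-1 : (M : Matrix 1) → det A 1 M ≈ M Fin.zero Fin.zero
  det-1 M = trans (+-identityʳ _) (trans (*-identityˡ _) (*-identityʳ _))

  ZeroBlock : ∀ {n} → Matrix n → ℕ → ℕ → Set ℓ
  ZeroBlock M a b = ∀ i j → a ≤ toℕ i → toℕ j < b → M i j ≈ 0#

  minor-zeroBlockˡ : ∀ {n} (M : Matrix (suc n)) {a b} j →
    ZeroBlock M (suc a) (suc b) → ZeroBlock (minor M j) a b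
  minor-zeroBlockˡ M j zb i k a≤i k<b =
    zb (Fin.suc i) (punchIn j k) (s≤s a≤i) (≤-<-trans (toℕ-punchIn-≤ j k) (s≤s k<b))

  minor-zeroBlockʳ : ∀ {n} (M : Matrix (suc n)) {a b} j → b ≤ toℕ j →
    ZeroBlock M a b → ZeroBlock (minor M j) (pred a) b
  minor-zeroBlockʳ M {a} j b≤j zb i k a-1≤i k<b =
    zb (Fin.suc i) (punchIn j k) (pred≤⇒≤suc a a-1≤i)
       (subst (_< _) (≡.sym (toℕ-punchIn-< j k (<-≤-trans k<b b≤j))) k<b)
    where
    pred≤⇒≤suc : ∀ a {i} → pred a ≤ i → a ≤ suc i
    pred≤⇒≤suc zero    _ = z≤n
    pred≤⇒≤suc (suc a) a≤i = s≤s a≤i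

  -- The n − a rows from a on are supported on the n − b < n − a columns from b on.
  mutual
    det-zeroBlock : ∀ n (M : Matrix n) a b → a < b → b ≤ n → ZeroBlock M a b → det A n M ≈ 0#
    det-zeroBlock zero    M a b a<b b≤0 zb = ⊥-elim (n≮0 (<-≤-trans a<b b≤0))
    det-zeroBlock (suc n) M a b a<b b≤n zb =
      sumFin-zero (suc n) λ j → laplaceTerm-zero M j (laplaceFactor-zero M a<b b≤n zb j)

    laplaceFactor-zero : ∀ {n} (M : Matrix (suc n)) {a b} → a < b → b ≤ suc n → ZeroBlock M a b →
      ∀ j → M Fin.zero j ≈ 0# ⊎ det A n (minor M j) ≈ 0#
    laplaceFactor-zero {n} M {a} {b} a<b b≤n zb j with toℕ j <? b
    ... | no j≮b = inj₂ (det-zeroBlock n (minor M j) (pred a) b (≤-<-trans pred[n]≤n a<b)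
                           (≤-trans (≮⇒≥ j≮b) (toℕ≤pred[n] j)) (minor-zeroBlockʳ M j (≮⇒≥ j≮b) zb))
    laplaceFactor-zero M {zero} _ _ zb j | yes j<b = inj₁ (zb Fin.zero j z≤n j<b)
    laplaceFactor-zero {n} M {suc a} {suc b} (s≤s a<b) (s≤s b≤n) zb j | yes _ =
      inj₂ (det-zeroBlock n (minor M j) a b a<b b≤n (minor-zeroBlockˡ M j zb))

  topLeft : ∀ k m → Matrix (k ℕ.+ m) → Matrix k
  topLeft k m M i j = M (i ↑ˡ m) (j ↑ˡ m)

  bottomRight : ∀ k m → Matrix (k ℕ.+ m) → Matrix m
  bottomRight k m M i j = M (k ↑ʳ i) (k ↑ʳ j)

  det-blockTriangular : ∀ k m (M : Matrix (k ℕ.+ m)) → ZeroBlock M k k →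
    det A (k ℕ.+ m) M ≈ det A k (topLeft k m M) * det A m (bottomRight k m M)
  det-blockTriangular zero    m M zb = sym (*-identityˡ _)
  det-blockTriangular (suc k) m M zb = begin
      sumFin A (suc k ℕ.+ m) (laplaceTerm M)
    ≈⟨ sumFin-split (suc k) m (laplaceTerm M) ⟩
      sumFin A (suc k) (λ j → laplaceTerm M (j ↑ˡ m)) + sumFin A m (λ j → laplaceTerm M (suc k ↑ʳ j))
    ≈⟨ +-cong (sumFin-cong (suc k) leftTerm) (sumFin-zero m rightTerm-zero) ⟩
      sumFin A (suc k) (λ j → laplaceTerm TL j * det A m BR) + 0#
    ≈⟨ +-identityʳ _ ⟩
      sumFin A (suc k) (λ j → laplaceTerm TL j * det A m BR)
    ≈⟨ *-distribʳ-sumFin (suc k) (laplaceTerm TL) (det A m BR) ⟨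
      det A (suc k) TL * det A m BR
    ∎
    where
    TL = topLeft (suc k) m M
    BR = bottomRight (suc k) m M

    leftTerm : ∀ j → laplaceTerm M (j ↑ˡ m) ≈ laplaceTerm TL j * det A m BR
    leftTerm j = begin
        sign A (toℕ (j ↑ˡ m)) * (M Fin.zero (j ↑ˡ m) * det A (k ℕ.+ m) (minor M (j ↑ˡ m)))
      ≈⟨ *-cong (reflexive (cong (sign A) (toℕ-↑ˡ j m))) (*-cong refl
           (det-blockTriangular k m (minor M (j ↑ˡ m)) λ i c k≤i c<k →
              zb (Fin.suc i) _ (s≤s k≤i) (≤-<-trans (toℕ-punchIn-≤ (j ↑ˡ m) c) (s≤s c<k)))) ⟩
        sign A (toℕ j) * (TL Fin.zero j * (det A k (topLeft k m (minor M (j ↑ˡ m)))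
                                           * det A m (bottomRight k m (minor M (j ↑ˡ m)))))
      ≈⟨ *-cong refl (*-cong refl (*-cong
           (det-cong k λ i c → reflexive (cong (M (Fin.suc (i ↑ˡ m))) (punchIn-↑ˡ m j c)))
           (det-cong m λ i c → reflexive (cong (M (Fin.suc (k ↑ʳ i))) (punchIn-↑ˡ-↑ʳ k j c))))) ⟩
        sign A (toℕ j) * (TL Fin.zero j * (det A k (minor TL j) * det A m BR))
      ≈⟨ *-cong refl (*-assoc _ _ _) ⟨
        sign A (toℕ j) * (TL Fin.zero j * det A k (minor TL j) * det A m BR)
      ≈⟨ *-assoc _ _ _ ⟨
        laplaceTerm TL j * det A m BR
      ∎

    rightTerm-zero : ∀ j → laplaceTerm M (suc k ↑ʳ j) ≈ 0#
    rightTerm-zero j = laplaceTerm-zero M (suc k ↑ʳ j) (inj₂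
      (det-zeroBlock (k ℕ.+ m) (minor M (suc k ↑ʳ j)) k (suc k) ≤-refl
        (m<m+n k (≤-<-trans z≤n (toℕ<n j)))
        λ i c k≤i c<1+k → zb (Fin.suc i) _ (s≤s k≤i)
          (subst (_< suc k) (≡.sym (toℕ-punchIn-< (suc k ↑ʳ j) c
             (<-≤-trans c<1+k (subst (suc k ≤_) (≡.sym (toℕ-↑ʳ (suc k) j)) (m≤m+n (suc k) (toℕ j))))))
             c<1+k)))

jtDegree : ℕ → ℕ → ℕ → ℕ → ℤ
jtDegree u v i j = ((+ u ℤ.- + v) ℤ.- + suc i) ℤ.+ + suc j

i<j⇒i-j<0 : ∀ {i j} → i ℤ.< j → i ℤ.- j ℤ.< 0ℤ
i<j⇒i-j<0 {i} {j} i<j = subst (i ℤ.- j ℤ.<_) (ℤ.+-inverseʳ j) (ℤ.+-monoˡ-< (ℤ.- j) i<j)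

jtDegree-negative : ∀ {u v i j} → u ≤ v → j < i → jtDegree u v i j ℤ.< 0ℤ
jtDegree-negative {u} {v} {i} {j} u≤v j<i =
  subst (ℤ._< 0ℤ) (≡.sym (rearrange (+ u) (+ v) (+ suc i) (+ suc j)))
    (i<j⇒i-j<0 (+<+ (+-mono-≤-< u≤v (s≤s j<i))))
  where
  rearrange : ∀ (u v i j : ℤ) → ((u ℤ.- v) ℤ.- i) ℤ.+ j ≡ (u ℤ.+ j) ℤ.- (v ℤ.+ i)
  rearrange = solve-∀

jtDegree-diagonal : ∀ u i → jtDegree u u i i ≡ 0ℤ
jtDegree-diagonal u i = cancel (+ u) (+ suc i)
  where
  cancel : ∀ (u i : ℤ) → ((u ℤ.- u) ℤ.- i) ℤ.+ i ≡ 0ℤ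
  cancel = solve-∀

SameRow : (a b c d : ℕ → ℕ) → ℕ → Set
SameRow a b c d r = a r ≡ c r × b r ≡ d r

RowsMatch : (a b c d : ℕ → ℕ) → ℕ → Set
RowsMatch a b c d r = SameRow a b c d r ⊎ (a r ≡ b r × c r ≡ d r)

module JacobiTrudi {c ℓ : Level} (A : CommutativeRing c ℓ) (x : ℕ → ℤ → CommutativeRing.Carrier A) where
  open CommutativeRing A
  open Determinant A
  open import Relation.Binary.Reasoning.Setoid setoid

  -- Indices are 0-based: `jtMatrix x λp μ n` is definitionally
  -- `jtWindow (row λp) (row μ) 0 n`, whose (i, j) entry is φ^(b_j − j) h_(a_i − b_j − i + j).
  jtEntry : ℕ → ℕ → ℕ → ℕ → Carrier
  jtEntry u v i j = hEval A x (jtDegree u v i j) (((+ v) ℤ.- (+ suc j)) ℤ.+ (+ 1))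

  jt : (a b : ℕ → ℕ) → ℕ → ℕ → Carrier
  jt a b i j = jtEntry (a i) (b j) i j

  jtWindow : (a b : ℕ → ℕ) → ℕ → ∀ m → Matrix m
  jtWindow a b p m i j = jt a b (p ℕ.+ toℕ i) (p ℕ.+ toℕ j)

  jtDet : (a b : ℕ → ℕ) → ℕ → ℕ → Carrier
  jtDet a b p m = det A m (jtWindow a b p m)

  hEval-negative : ∀ {r} s → r ℤ.< 0ℤ → hEval A x r s ≈ 0#
  hEval-negative { -[1+ _ ]} s _        = refl
  hEval-negative {+ _}      s (+<+ ())

  jt-vanishes : ∀ a b {i j} → a i ≤ b j → j < i → jt a b i j ≈ 0#
  jt-vanishes a b a≤b j<i = hEval-negative _ (jtDegree-negative a≤b j<i)

  jt-diagonal : ∀ a b {i} → a i ≡ b i → jt a b i i ≈ 1#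
  jt-diagonal a b {i} e rewrite e | jtDegree-diagonal (b i) i = refl

  jtDet-split : ∀ a b p k m → (∀ r s → p ℕ.+ k ≤ r → s < p ℕ.+ k → a r ≤ b s) →
    jtDet a b p (k ℕ.+ m) ≈ jtDet a b p k * jtDet a b (p ℕ.+ k) m
  jtDet-split a b p k m separated = begin
      det A (k ℕ.+ m) W
    ≈⟨ det-blockTriangular k m W zeroBlock ⟩
      det A k (topLeft k m W) * det A m (bottomRight k m W)
    ≈⟨ *-cong (det-cong k λ i j → reflexive (≡.cong₂ (λ s t → jt a b (p ℕ.+ s) (p ℕ.+ t))
                                                       (toℕ-↑ˡ i m) (toℕ-↑ˡ j m)))
              (det-cong m λ i j → reflexive (≡.cong₂ (jt a b) (shift i) (shift j))) ⟩
      jtDet a b p k * jtDet a b (p ℕ.+ k) m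
    ∎
    where
    W = jtWindow a b p (k ℕ.+ m)
    shift : ∀ i → p ℕ.+ toℕ (k ↑ʳ i) ≡ p ℕ.+ k ℕ.+ toℕ i
    shift i = ≡.trans (cong (p ℕ.+_) (toℕ-↑ʳ k i)) (≡.sym (ℕₚ.+-assoc p k (toℕ i)))
    zeroBlock : ZeroBlock W k k
    zeroBlock i j k≤i j<k = jt-vanishes a b
      (separated _ _ (+-monoʳ-≤ p k≤i) (+-monoʳ-< p j<k)) (+-monoʳ-< p (<-≤-trans j<k k≤i))

  jtDet-one : ∀ a b p → a p ≡ b p → jtDet a b p 1 ≈ 1#
  jtDet-one a b p e = trans (det-1 (jtWindow a b p 1))
    (jt-diagonal a b (subst (λ r → a r ≡ b r) (≡.sym (ℕₚ.+-identityʳ p)) e))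

  module _ {a b : ℕ → ℕ} (a↓ : Antitonic₁ _≤_ _≤_ a) (b↓ : Antitonic₁ _≤_ _≤_ b) where

    emptyRow-separates : ∀ {q r s} → a q ≡ b q → q ≤ r → s ≤ q → a r ≤ b s
    emptyRow-separates e q≤r s≤q = ≤-trans (a↓ q≤r) (subst (_≤ b _) (≡.sym e) (b↓ s≤q))

    jtDet-splitAtEmptyRow : ∀ p k m → a (p ℕ.+ k) ≡ b (p ℕ.+ k) →
      jtDet a b p (k ℕ.+ m) ≈ jtDet a b p k * jtDet a b (p ℕ.+ k) m
    jtDet-splitAtEmptyRow p k m e =
      jtDet-split a b p k m λ r s q≤r s<q → emptyRow-separates e q≤r (<⇒≤ s<q)

    jtDet-dropEmptyRow : ∀ p m → a p ≡ b p → jtDet a b p (suc m) ≈ jtDet a b (suc p) m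
    jtDet-dropEmptyRow p m e = begin
        jtDet a b p (1 ℕ.+ m)
      ≈⟨ jtDet-split a b p 1 m separated ⟩
        jtDet a b p 1 * jtDet a b (p ℕ.+ 1) m
      ≈⟨ *-cong (jtDet-one a b p e) refl ⟩
        1# * jtDet a b (p ℕ.+ 1) m
      ≈⟨ *-identityˡ _ ⟩
        jtDet a b (p ℕ.+ 1) m
      ≡⟨ cong (λ q → jtDet a b q m) (ℕₚ.+-comm p 1) ⟩
        jtDet a b (suc p) m
      ∎
      where
      separated : ∀ r s → p ℕ.+ 1 ≤ r → s < p ℕ.+ 1 → a r ≤ b s
      separated r s p+1≤r s<p+1 = emptyRow-separates e (≤-trans (m≤m+n p 1) p+1≤r)
        (m<1+n⇒m≤n (subst (s <_) (ℕₚ.+-comm p 1) s<p+1))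

    jtDet-emptyRows : ∀ p m → (∀ r → p ≤ r → a r ≡ b r) → jtDet a b p m ≈ 1#
    jtDet-emptyRows p zero    e = refl
    jtDet-emptyRows p (suc m) e = trans (jtDet-dropEmptyRow p m (e p ≤-refl))
      (jtDet-emptyRows (suc p) m λ r p<r → e r (<⇒≤ p<r))

    jtDet-trailingEmptyRows : ∀ p n q → (∀ r → p ℕ.+ n ≤ r → a r ≡ b r) →
      jtDet a b p (n ℕ.+ q) ≈ jtDet a b p n
    jtDet-trailingEmptyRows p n q e = begin
        jtDet a b p (n ℕ.+ q)
      ≈⟨ jtDet-splitAtEmptyRow p n q (e (p ℕ.+ n) ≤-refl) ⟩
        jtDet a b p n * jtDet a b (p ℕ.+ n) q
      ≈⟨ *-cong refl (jtDet-emptyRows (p ℕ.+ n) q e) ⟩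
        jtDet a b p n * 1#
      ≈⟨ *-identityʳ _ ⟩
        jtDet a b p n
      ∎

  jtDet-sameRows : ∀ a b c d p k → (∀ t → t < k → SameRow a b c d (p ℕ.+ t)) →
    jtDet a b p k ≈ jtDet c d p k
  jtDet-sameRows a b c d p k same = det-cong k λ i j → reflexive
    (≡.cong₂ (λ u v → jtEntry u v (p ℕ.+ toℕ i) (p ℕ.+ toℕ j))
       (proj₁ (same (toℕ i) (toℕ<n i))) (proj₂ (same (toℕ j) (toℕ<n j))))

  module _ {a b c d : ℕ → ℕ}
           (a↓ : Antitonic₁ _≤_ _≤_ a) (b↓ : Antitonic₁ _≤_ _≤_ b)
           (c↓ : Antitonic₁ _≤_ _≤_ c) (d↓ : Antitonic₁ _≤_ _≤_ d)
           (match : ∀ r → RowsMatch a b c d r) where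

    -- Rows p, …, p + k − 1 are already known to agree; an empty row factors both determinants.
    jtDet-matchingRows : ∀ m p k → (∀ t → t < k → SameRow a b c d (p ℕ.+ t)) →
      jtDet a b p (k ℕ.+ m) ≈ jtDet c d p (k ℕ.+ m)
    jtDet-matchingRows zero p k same rewrite ℕₚ.+-identityʳ k = jtDet-sameRows a b c d p k same
    jtDet-matchingRows (suc m) p k same with match (p ℕ.+ k)
    ... | inj₁ sameₖ rewrite ℕₚ.+-suc k m = jtDet-matchingRows m p (suc k) same′
      where
      same′ : ∀ t → t < suc k → SameRow a b c d (p ℕ.+ t)
      same′ t t<1+k with m≤n⇒m<n∨m≡n (m<1+n⇒m≤n t<1+k)
      ... | inj₁ t<k    = same t t<k
      ... | inj₂ ≡.refl = sameₖ
    ... | inj₂ (emptyˡ , emptyʳ) = begin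
        jtDet a b p (k ℕ.+ suc m)
      ≈⟨ jtDet-splitAtEmptyRow a↓ b↓ p k (suc m) emptyˡ ⟩
        jtDet a b p k * jtDet a b (p ℕ.+ k) (suc m)
      ≈⟨ *-cong refl (jtDet-dropEmptyRow a↓ b↓ (p ℕ.+ k) m emptyˡ) ⟩
        jtDet a b p k * jtDet a b (suc (p ℕ.+ k)) m
      ≈⟨ *-cong (jtDet-sameRows a b c d p k same) (jtDet-matchingRows m (suc (p ℕ.+ k)) 0 λ _ ()) ⟩
        jtDet c d p k * jtDet c d (suc (p ℕ.+ k)) m
      ≈⟨ *-cong refl (jtDet-dropEmptyRow c↓ d↓ (p ℕ.+ k) m emptyʳ) ⟨
        jtDet c d p k * jtDet c d (p ℕ.+ k) (suc m)
      ≈⟨ jtDet-splitAtEmptyRow c↓ d↓ p k (suc m) emptyʳ ⟨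
        jtDet c d p (k ℕ.+ suc m)
      ∎

Ioc : ℕ → ℕ → ℕ → Set
Ioc lo hi j = lo < j × j ≤ hi

Ioc-⊆⇒bounds : ∀ {lo hi lo′ hi′} → lo < hi → (∀ j → Ioc lo hi j → Ioc lo′ hi′ j) → lo′ ≤ lo × hi ≤ hi′
Ioc-⊆⇒bounds {lo} {hi} lo<hi ⊆ =
  m<1+n⇒m≤n (proj₁ (⊆ (suc lo) (≤-refl , lo<hi))) , proj₂ (⊆ hi (lo<hi , ≤-refl))

Ioc-ext : ∀ {lo hi lo′ hi′} → lo ≤ hi → lo′ ≤ hi′ → (∀ j → Ioc lo hi j ⇔ Ioc lo′ hi′ j) →
  (hi ≡ hi′ × lo ≡ lo′) ⊎ (hi ≡ lo × hi′ ≡ lo′)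
Ioc-ext {lo} {hi} {lo′} {hi′} lo≤hi lo′≤hi′ same with lo <? hi | lo′ <? hi′
... | yes lo<hi | yes lo′<hi′ =
  let lo′≤lo , hi≤hi′ = Ioc-⊆⇒bounds lo<hi (λ j → Equivalence.to (same j))
      lo≤lo′ , hi′≤hi = Ioc-⊆⇒bounds lo′<hi′ (λ j → Equivalence.from (same j))
  in inj₁ (≤-antisym hi≤hi′ hi′≤hi , ≤-antisym lo≤lo′ lo′≤lo)
... | yes lo<hi | no lo′≮hi′ =
  let lo′≤lo , hi≤hi′ = Ioc-⊆⇒bounds lo<hi (λ j → Equivalence.to (same j))
  in ⊥-elim (lo′≮hi′ (≤-<-trans lo′≤lo (<-≤-trans lo<hi hi≤hi′)))
... | no lo≮hi | yes lo′<hi′ =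
  let lo≤lo′ , hi′≤hi = Ioc-⊆⇒bounds lo′<hi′ (λ j → Equivalence.from (same j))
  in ⊥-elim (lo≮hi (≤-<-trans lo≤lo′ (<-≤-trans lo′<hi′ hi′≤hi)))
... | no lo≮hi | no lo′≮hi′ = inj₂ (≤-antisym (≮⇒≥ lo≮hi) lo≤hi , ≤-antisym (≮⇒≥ lo′≮hi′) lo′≤hi′)

-- 0-based: row λp r = λ_(r+1).
row : Partition → ℕ → ℕ
row λp = nth (parts λp)

nth-antitone : ∀ {xs} → Linked _≥_ xs → Antitonic₁ _≤_ _≤_ (nth xs)
nth-antitone []                   _         = z≤n
nth-antitone [-]        {zero}    z≤n       = ≤-refl
nth-antitone [-]        {suc _}   z≤n       = z≤n
nth-antitone [-]                  (s≤s _)   = z≤n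
nth-antitone (_ ∷ _)    {zero}    z≤n       = ≤-refl
nth-antitone (x≥y ∷ xs) {suc i}   z≤n       = ≤-trans (nth-antitone xs {i} z≤n) x≥y
nth-antitone (_ ∷ xs)             (s≤s j≤i) = nth-antitone xs j≤i

row-antitone : ∀ λp → Antitonic₁ _≤_ _≤_ (row λp)
row-antitone λp = nth-antitone (decreasing λp)

nth-beyondLength : ∀ xs {r} → length xs ≤ r → nth xs r ≡ 0
nth-beyondLength []                  _         = ≡.refl
nth-beyondLength (_ ∷ xs) {suc r}    (s≤s len≤r) = nth-beyondLength xs len≤r

inSkew⇔Ioc : ∀ λp μ r j → InSkew λp μ (suc r) j ⇔ Ioc (row μ r) (row λp r) j
inSkew⇔Ioc λp μ r j = mk⇔
  (λ ((_ , 1≤j , j≤λ) , j∉μ) → ≰⇒> (λ j≤μ → j∉μ (s≤s z≤n , 1≤j , j≤μ)) , j≤λ)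
  (λ (μ<j , j≤λ) → (s≤s z≤n , ≤-trans (s≤s z≤n) μ<j , j≤λ) , λ (_ , _ , j≤μ) → <⇒≱ μ<j j≤μ)

skewRows-match : ∀ {λp μ α β} → μ ⊆ₚ λp → β ⊆ₚ α →
  (∀ i j → InSkew λp μ i j ⇔ InSkew α β i j) → ∀ r → RowsMatch (row λp) (row μ) (row α) (row β) r
skewRows-match {λp} {μ} {α} {β} μ⊆λ β⊆α sameCells r =
  Ioc-ext (μ⊆λ (suc r) (s≤s z≤n)) (β⊆α (suc r) (s≤s z≤n)) λ j →
    ⇔.trans (⇔.sym (inSkew⇔Ioc λp μ r j)) (⇔.trans (sameCells (suc r) j) (inSkew⇔Ioc α β r j))

module _ {c ℓ′ : Level} (A : CommutativeRing c ℓ′) (x : ℕ → ℤ → CommutativeRing.Carrier A) where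
  open CommutativeRing A
  open JacobiTrudi A x

  skewSchur≈jtDet : ∀ λp μ {N} → ℓ λp ⊔ ℓ μ ≤ N → skewSchur A x λp μ ≈ jtDet (row λp) (row μ) 0 N
  skewSchur≈jtDet λp μ {N} n≤N = begin
      jtDet (row λp) (row μ) 0 n
    ≈⟨ jtDet-trailingEmptyRows (row-antitone λp) (row-antitone μ) 0 n (N ∸ n) beyondRows-empty ⟨
      jtDet (row λp) (row μ) 0 (n ℕ.+ (N ∸ n))
    ≡⟨ cong (jtDet (row λp) (row μ) 0) (ℕₚ.m+[n∸m]≡n n≤N) ⟩
      jtDet (row λp) (row μ) 0 N
    ∎
    where
    open import Relation.Binary.Reasoning.Setoid setoid
    n = ℓ λp ⊔ ℓ μ
    beyondRows-empty : ∀ r → n ≤ r → row λp r ≡ row μ r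
    beyondRows-empty r n≤r = ≡.trans (nth-beyondLength (parts λp) (≤-trans (m≤m⊔n _ _) n≤r))
                                     (≡.sym (nth-beyondLength (parts μ) (≤-trans (m≤n⊔m _ _) n≤r)))

mainTheorem15 : (λp μ α β : Partition) → μ ⊆ₚ λp → β ⊆ₚ α →
    (∀ i j → InSkew λp μ i j ⇔ InSkew α β i j) →
    ∀ {c ℓ} (A : CommutativeRing c ℓ) (x : ℕ → ℤ → CommutativeRing.Carrier A) →
    CommutativeRing._≈_ A (skewSchur A x λp μ) (skewSchur A x α β)
mainTheorem15 λp μ α β μ⊆λ β⊆α sameCells A x = begin
    skewSchur A x λp μ
  ≈⟨ skewSchur≈jtDet A x λp μ (m≤m⊔n n₁ n₂) ⟩
    jtDet (row λp) (row μ) 0 (n₁ ⊔ n₂)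
  ≈⟨ jtDet-matchingRows (row-antitone λp) (row-antitone μ) (row-antitone α) (row-antitone β)
       (skewRows-match μ⊆λ β⊆α sameCells) (n₁ ⊔ n₂) 0 0 (λ _ ()) ⟩
    jtDet (row α) (row β) 0 (n₁ ⊔ n₂)
  ≈⟨ skewSchur≈jtDet A x α β (m≤n⊔m n₁ n₂) ⟨
    skewSchur A x α β
  ∎
  where
  open CommutativeRing A using (setoid)
  open import Relation.Binary.Reasoning.Setoid setoid
  open JacobiTrudi A x using (jtDet; jtDet-matchingRows)
  n₁ = ℓ λp ⊔ ℓ μ
  n₂ = ℓ α ⊔ ℓ β
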